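{- Let $\mathbf{\Phi}=\{\Phi_1,\ldots,\Phi_r\}$ be a set of $d$-dimensional $k$-ary semialgebraic predicates. Then there is a $d$-dimensional semialgebraic predicate $\bar\Phi$ in $rk$ variables such that $\{\bar\Phi\}$ is Erdős–Szekeres if and only if $\mathbf{\Phi}$ is, and if they are Erdős–Szekeres, then $\mathrm{ES}_{\{\bar\Phi\}}(n)=\mathrm{ES}_{\mathbf{\Phi}}(n)$ for all $n\ge rk$.
   Context: A $d$-dimensional $k$-ary semialgebraic predicate $\Phi(\mathbf{x}_1,\ldots,\mathbf{x}_k)$, $\mathbf{x}_i\in\mathbb{R}^d$, is a Boolean combination of polynomial equations and inequalities with rational coefficients in the coordinates of the points. $\Phi$ holds everywhere on a sequence $(\mathbf{a}_1,\ldots,\mathbf{a}_n)$ of points of $\mathbb{R}^d$ if $\Phi(\mathbf{a}_{i_1},\ldots,\mathbf{a}_{i_k})$ holds for all $1\le i_1<\cdots<i_k\le n$. A finite set $\mathbf{\Phi}$ of predicates is Erdős–Szekeres if for every $n$ there exists $N$ such that every sequence of $N$ points in $\mathbb{R}^d$ has a subsequence of length $n$ on which some $\Phi\in\mathbf{\Phi}$ holds everywhere; $\mathrm{ES}_{\mathbf{\Phi}}(n)$ is the smallest such $N$. -}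

module Defs where

open import Level using (0ℓ)
open import Data.Nat using (ℕ; _*_) renaming (_<_ to _<ℕ_)
open import Data.Fin using (Fin) renaming (_<_ to _<F_)
open import Data.Product using (_×_; Σ; ∃; _,_)
open import Data.Sum using (_⊎_)
open import Data.Rational using (ℚ)
open import Relation.Nullary using (¬_)
open import Relation.Binary.PropositionalEquality using (_≡_)

data Poly (V : Set) : Set where
  con  : ℚ → Poly V
  var  : V → Poly V
  _⊕_  : Poly V → Poly V → Poly V
  _⊗_  : Poly V → Poly V → Poly V
  ⊖_   : Poly V → Poly V

data Formula (V : Set) : Set where
  _≐0   : Poly V → Formula V
  _>0   : Poly V → Formula V
  ¬ᶠ_   : Formula V → Formula V
  _∧ᶠ_  : Formula V → Formula V → Formula V
  _∨ᶠ_  : Formula V → Formula V → Formula V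

-- A d-dimensional k-ary semialgebraic predicate: variable (j , c) is the
-- c-th coordinate of the j-th point x_j.
Pred : ℕ → ℕ → Set
Pred d k = Formula (Fin k × Fin d)

record OrderedFieldℚ : Set₁ where
  field
    Carrier : Set
    zero#   : Carrier
    _+#_    : Carrier → Carrier → Carrier
    _*#_    : Carrier → Carrier → Carrier
    -#_     : Carrier → Carrier
    _<#_    : Carrier → Carrier → Set
    fromℚ   : ℚ → Carrier

module _ (R : OrderedFieldℚ) where
  open OrderedFieldℚ R

  evalP : {V : Set} → Poly V → (V → Carrier) → Carrier
  evalP (con q) ρ = fromℚ q
  evalP (var v) ρ = ρ v
  evalP (p ⊕ q) ρ = evalP p ρ +# evalP q ρ
  evalP (p ⊗ q) ρ = evalP p ρ *# evalP q ρ
  evalP (⊖ p)   ρ = -# evalP p ρ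

  ⟦_⟧ : {V : Set} → Formula V → (V → Carrier) → Set
  ⟦ p ≐0 ⟧   ρ = evalP p ρ ≡ zero#
  ⟦ p >0 ⟧   ρ = zero# <# evalP p ρ
  ⟦ ¬ᶠ φ ⟧   ρ = ¬ ⟦ φ ⟧ ρ
  ⟦ φ ∧ᶠ ψ ⟧ ρ = ⟦ φ ⟧ ρ × ⟦ ψ ⟧ ρ
  ⟦ φ ∨ᶠ ψ ⟧ ρ = ⟦ φ ⟧ ρ ⊎ ⟦ ψ ⟧ ρ

  Point : ℕ → Set
  Point d = Fin d → Carrier

  StrictlyIncreasing : {m N : ℕ} → (Fin m → Fin N) → Set
  StrictlyIncreasing f = ∀ i j → i <F j → f i <F f j

  HoldsEverywhere : {d k N : ℕ} → Pred d k → (Fin N → Point d) → Set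
  HoldsEverywhere {d} {k} {N} Φ a =
    (ι : Fin k → Fin N) → StrictlyIncreasing ι →
    ⟦ Φ ⟧ (λ { (j , c) → a (ι j) c })

  Good : {d k r : ℕ} → (Fin r → Pred d k) → ℕ → ℕ → Set
  Good {d} {k} {r} Φs n N =
    (a : Fin N → Point d) →
    Σ (Fin n → Fin N) λ s → StrictlyIncreasing s ×
      ∃ λ (i : Fin r) → HoldsEverywhere (Φs i) (λ t → a (s t))

  IsErdosSzekeres : {d k r : ℕ} → (Fin r → Pred d k) → Set
  IsErdosSzekeres Φs = ∀ n → ∃ λ N → Good Φs n N

  IsESValue : {d k r : ℕ} → (Fin r → Pred d k) → ℕ → ℕ → Set
  IsESValue Φs n N = Good Φs n N × (∀ M → M <ℕ N → ¬ Good Φs n M)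

single : {d k : ℕ} → Pred d k → Fin 1 → Pred d k
single Φ _ = Φ

module Submission where

-- Φ̄(x₁, …, x_rk) says that for some i, Φ i holds on every k-element subsequence of x, so
-- Φ i holding everywhere on a sequence makes Φ̄ hold everywhere on it. Conversely, if Φ̄
-- holds everywhere on n ≥ rk points, colour every rk-subsequence by such an i. Some colour i
-- covers every k-subsequence: otherwise one uncovered k-subsequence per colour would fit into
-- a common rk-subsequence, which then covers the one of its own colour. Hence for n ≥ rk
-- both sides have the same good N, and for small n one asks for n + rk points instead.

open import Defs
open import Data.Nat using (ℕ; _*_; _≤_)
open import Data.Fin using (Fin)
open import Data.Product using (_×_; Σ)
open import Function.Bundles using (_⇔_)

open import Data.Nat using (zero; suc; _+_; z≤n; s≤s; _≤′_; ≤′-refl; ≤′-step; s<s⁻¹) renaming (_<_ to _<ℕ_)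
open import Data.Nat.Properties
  using (≤-refl; ≤-reflexive; ≤-trans; ≤⇒≤′; n≤1+n; +-suc; +-monoʳ-≤; m≤m+n; m≤n+m)
open import Data.Fin using (zero; suc; punchOut; inject≤) renaming (_<_ to _<F_)
open import Data.Fin.Properties using (_≟_; punchIn-punchOut; toℕ-inject≤)
open import Data.Product using (_,_; proj₁; proj₂; ∃; ∃₂; map₁; uncurry)
open import Data.Sum using (inj₁; inj₂)
open import Data.Product.Function.NonDependent.Propositional using (_×-⇔_)
open import Data.Sum.Function.Propositional using (_⊎-⇔_)
open import Data.Empty using (⊥-elim)
open import Data.List using (List; []; _∷_; _++_; map; allFin)
open import Data.List.Relation.Unary.All as All using (All; []; _∷_; all?)
open import Data.List.Relation.Unary.Any as Any using (Any; any?)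
open import Data.List.Membership.Propositional using (_∈_; lose)
open import Data.List.Membership.Propositional.Properties using (∈-map⁺; ∈-++⁺ˡ; ∈-++⁺ʳ; ∈-allFin)
open import Data.Rational using (0ℚ)
open import Relation.Nullary using (¬_; Dec; yes; no)
open import Relation.Nullary.Decidable using (map′; ¬?; decidable-stable; _×-dec_)
open import Relation.Unary using (Decidable)
open import Relation.Binary.PropositionalEquality
  using (_≡_; _≢_; _≗_; refl; sym; trans; cong; cong₂; subst; subst₂)
open import Function.Bundles using (mk⇔; Equivalence)
open import Function using (_∘_)

module _ {A : Set} {xs : List A} (complete : ∀ x → x ∈ xs) where

  All⇔∀ : {P : A → Set} → All P xs ⇔ (∀ x → P x)
  All⇔∀ = mk⇔ (λ ps x → All.lookup ps (complete x)) (λ f → All.tabulate (λ {x} _ → f x))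

  Any⇔∃ : {P : A → Set} → Any P xs ⇔ ∃ P
  Any⇔∃ = mk⇔ Any.satisfied (λ (x , px) → lose (complete x) px)

  ∀? : {P : A → Set} → Decidable P → Dec (∀ x → P x)
  ∀? P? = map′ (Equivalence.to All⇔∀) (Equivalence.from All⇔∀) (all? P? xs)

  ∃? : {P : A → Set} → Decidable P → Dec (∃ P)
  ∃? P? = map′ (Equivalence.to Any⇔∃) (Equivalence.from Any⇔∃) (any? P? xs)

  ¬∀⇒∃¬ : {P : A → Set} → Decidable P → ¬ (∀ x → P x) → ∃ λ x → ¬ P x
  ¬∀⇒∃¬ P? ¬∀ with ∃? (¬? ∘ P?)
  ... | yes ∃¬ = ∃¬
  ... | no ¬∃¬ = ⊥-elim (¬∀ λ x → decidable-stable (P? x) (λ ¬px → ¬∃¬ (x , ¬px)))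

-- Thinnings: order-preserving embeddings of Fin a into Fin n, i.e. a-element subsets of Fin n

data Thin : ℕ → ℕ → Set where
  done : Thin 0 0
  skip : ∀ {a n} → Thin a n → Thin a (suc n)
  keep : ∀ {a n} → Thin a n → Thin (suc a) (suc n)

embed : ∀ {a n} → Thin a n → Fin a → Fin n
embed (skip t) j       = suc (embed t j)
embed (keep t) zero    = zero
embed (keep t) (suc j) = suc (embed t j)

Increasing : ∀ {a n} → (Fin a → Fin n) → Set
Increasing f = ∀ i j → i <F j → f i <F f j

embed-increasing : ∀ {a n} (t : Thin a n) → Increasing (embed t)
embed-increasing (skip t) i       j       i<j       = s≤s (embed-increasing t i j i<j)
embed-increasing (keep t) zero    (suc j) _         = s≤s z≤n
embed-increasing (keep t) (suc i) (suc j) (s≤s i<j) = s≤s (embed-increasing t i j i<j)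

inject≤-increasing : ∀ {m n} (m≤n : m ≤ n) → Increasing (λ i → inject≤ i m≤n)
inject≤-increasing m≤n i j i<j =
  subst₂ _<ℕ_ (sym (toℕ-inject≤ i m≤n)) (sym (toℕ-inject≤ j m≤n)) i<j

∘-increasing : ∀ {a b c} {f : Fin b → Fin c} {g : Fin a → Fin b} →
               Increasing f → Increasing g → Increasing (f ∘ g)
∘-increasing f↑ g↑ i j i<j = f↑ _ _ (g↑ i j i<j)

none : ∀ {n} → Thin 0 n
none {zero}  = done
none {suc n} = skip none

thinnings : ∀ a n → List (Thin a n)
thinnings zero    zero    = done ∷ []
thinnings (suc a) zero    = []
thinnings zero    (suc n) = map skip (thinnings zero n)
thinnings (suc a) (suc n) = map skip (thinnings (suc a) n) ++ map keep (thinnings a n)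

∈-thinnings : ∀ {a n} (t : Thin a n) → t ∈ thinnings a n
∈-thinnings done               = Any.here refl
∈-thinnings {zero}  (skip t)   = ∈-map⁺ skip (∈-thinnings t)
∈-thinnings {suc a} (skip t)   = ∈-++⁺ˡ (∈-map⁺ skip (∈-thinnings t))
∈-thinnings {suc a} (keep t)   = ∈-++⁺ʳ _ (∈-map⁺ keep (∈-thinnings t))

module Predecessor {a n : ℕ} (ι : Fin a → Fin (suc n)) (ι↑ : Increasing ι)
                   (ι≢0 : ∀ j → ι j ≢ zero) where

  ι′ : Fin a → Fin n
  ι′ j = punchOut (ι≢0 j ∘ sym)

  suc∘ι′ : suc ∘ ι′ ≗ ι
  suc∘ι′ j = punchIn-punchOut (ι≢0 j ∘ sym)

  ι′↑ : Increasing ι′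
  ι′↑ i j i<j = s<s⁻¹ (subst₂ _<F_ (sym (suc∘ι′ i)) (sym (suc∘ι′ j)) (ι↑ i j i<j))

above⇒≢0 : ∀ {n} {i j : Fin (suc n)} → i <F j → j ≢ zero
above⇒≢0 i<j refl with () ← i<j

increasing⇒thin : ∀ {a n} (ι : Fin a → Fin n) → Increasing ι → Σ (Thin a n) λ t → embed t ≗ ι
increasing⇒thin {zero}            ι ι↑ = none , λ ()
increasing⇒thin {suc a} {zero}    ι ι↑ with () ← ι zero
increasing⇒thin {suc a} {suc n}   ι ι↑ with ι zero in ι0
... | zero =
  let (t , t≗ι′) = increasing⇒thin ι′ ι′↑
  in keep t , λ { zero → sym ι0 ; (suc j) → trans (cong suc (t≗ι′ j)) (suc∘ι′ j) }
  where
    tail≢0 : ∀ j → ι (suc j) ≢ zero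
    tail≢0 j = above⇒≢0 (ι↑ zero (suc j) (s≤s z≤n))
    tail↑ : Increasing (ι ∘ suc)
    tail↑ i j i<j = ι↑ (suc i) (suc j) (s≤s i<j)
    open Predecessor (ι ∘ suc) tail↑ tail≢0
... | suc _ =
  let (t , t≗ι′) = increasing⇒thin ι′ ι′↑
  in skip t , λ j → trans (cong suc (t≗ι′ j)) (suc∘ι′ j)
  where
    ι≢0 : ∀ j → ι j ≢ zero
    ι≢0 zero    ι0≡0 with () ← trans (sym ι0) ι0≡0
    ι≢0 (suc j) = above⇒≢0 (ι↑ zero (suc j) (s≤s z≤n))
    open Predecessor ι ι↑ ι≢0

infix 4 _⊆_ _⊆?_

data _⊆_ : ∀ {a b n} → Thin a n → Thin b n → Set where
  done : done ⊆ done
  skip : ∀ {a b n} {t : Thin a n} {s : Thin b n} → t ⊆ s → skip t ⊆ skip s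
  skip-keep : ∀ {a b n} {t : Thin a n} {s : Thin b n} → t ⊆ s → skip t ⊆ keep s
  keep : ∀ {a b n} {t : Thin a n} {s : Thin b n} → t ⊆ s → keep t ⊆ keep s

_⊆?_ : ∀ {a b n} (t : Thin a n) (s : Thin b n) → Dec (t ⊆ s)
done   ⊆? done   = yes done
skip t ⊆? skip s = map′ skip (λ { (skip t⊆s) → t⊆s }) (t ⊆? s)
skip t ⊆? keep s = map′ skip-keep (λ { (skip-keep t⊆s) → t⊆s }) (t ⊆? s)
keep t ⊆? skip s = no λ ()
keep t ⊆? keep s = map′ keep (λ { (keep t⊆s) → t⊆s }) (t ⊆? s)

⊆-refl : ∀ {a n} (t : Thin a n) → t ⊆ t
⊆-refl done     = done
⊆-refl (skip t) = skip (⊆-refl t)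
⊆-refl (keep t) = keep (⊆-refl t)

⊆-trans : ∀ {a b c n} {t : Thin a n} {s : Thin b n} {u : Thin c n} → t ⊆ s → s ⊆ u → t ⊆ u
⊆-trans done            done            = done
⊆-trans (skip t⊆s)      (skip s⊆u)      = skip (⊆-trans t⊆s s⊆u)
⊆-trans (skip t⊆s)      (skip-keep s⊆u) = skip-keep (⊆-trans t⊆s s⊆u)
⊆-trans (skip-keep t⊆s) (keep s⊆u)      = skip-keep (⊆-trans t⊆s s⊆u)
⊆-trans (keep t⊆s)      (keep s⊆u)      = keep (⊆-trans t⊆s s⊆u)

⊆⇒factor : ∀ {a b n} {t : Thin a n} {s : Thin b n} → t ⊆ s →
           Σ (Thin a b) λ f → embed s ∘ embed f ≗ embed t
⊆⇒factor done = done , λ ()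
⊆⇒factor (skip t⊆s) = let (f , e) = ⊆⇒factor t⊆s in f , cong suc ∘ e
⊆⇒factor (skip-keep t⊆s) = let (f , e) = ⊆⇒factor t⊆s in skip f , cong suc ∘ e
⊆⇒factor (keep t⊆s) = let (f , e) = ⊆⇒factor t⊆s in
  keep f , λ { zero → refl ; (suc j) → cong suc (e j) }

union : ∀ {a b n} (t : Thin a n) (s : Thin b n) →
        ∃₂ λ u (v : Thin u n) → u ≤ a + b × t ⊆ v × s ⊆ v
union done done = 0 , done , z≤n , done , done
union (skip t) (skip s) =
  let (u , v , u≤ , t⊆v , s⊆v) = union t s in u , skip v , u≤ , skip t⊆v , skip s⊆v
union {a} {suc b} (skip t) (keep s) =
  let (u , v , u≤ , t⊆v , s⊆v) = union t s
  in suc u , keep v , ≤-trans (s≤s u≤) (≤-reflexive (sym (+-suc a b))) , skip-keep t⊆v , keep s⊆v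
union (keep t) (skip s) =
  let (u , v , u≤ , t⊆v , s⊆v) = union t s in suc u , keep v , s≤s u≤ , keep t⊆v , skip-keep s⊆v
union {suc a} {suc b} (keep t) (keep s) =
  let (u , v , u≤ , t⊆v , s⊆v) = union t s
  in suc u , keep v , s≤s (≤-trans u≤ (+-monoʳ-≤ a (n≤1+n b))) , keep t⊆v , keep s⊆v

grow : ∀ {a n} (t : Thin a n) → a <ℕ n → Σ (Thin (suc a) n) λ s → t ⊆ s
grow (skip t) _ = keep t , skip-keep (⊆-refl t)
grow (keep t) (s≤s a<n) = let (s , t⊆s) = grow t a<n in keep s , keep t⊆s

extend : ∀ {a m n} (t : Thin a n) → a ≤ m → m ≤ n → Σ (Thin m n) λ s → t ⊆ s
extend {a} {n = n} t a≤m m≤n = go (≤⇒≤′ a≤m) m≤n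
  where
    go : ∀ {m} → a ≤′ m → m ≤ n → Σ (Thin m n) λ s → t ⊆ s
    go ≤′-refl       _   = t , ⊆-refl t
    go (≤′-step a≤m) m<n =
      let (s , t⊆s) = go a≤m (≤-trans (n≤1+n _) m<n)
          (s′ , s⊆s′) = grow s m<n
      in s′ , ⊆-trans t⊆s s⊆s′

⋃ : ∀ {r k n} (ts : Fin r → Thin k n) → ∃₂ λ u (v : Thin u n) → u ≤ r * k × ∀ i → ts i ⊆ v
⋃ {zero} ts = 0 , none , z≤n , λ ()
⋃ {suc r} {k} ts =
  let (u , v , u≤ , ts⊆v) = ⋃ (ts ∘ suc)
      (w , x , w≤ , t₀⊆x , v⊆x) = union (ts zero) v
  in w , x , ≤-trans w≤ (+-monoʳ-≤ k u≤) , λ { zero → t₀⊆x ; (suc i) → ⊆-trans (ts⊆v i) v⊆x }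

cover : ∀ {r k m n} (ts : Fin r → Thin k n) → r * k ≤ m → m ≤ n →
        Σ (Thin m n) λ s → ∀ i → ts i ⊆ s
cover ts rk≤m m≤n =
  let (u , v , u≤rk , ts⊆v) = ⋃ ts
      (s , v⊆s) = extend v (≤-trans u≤rk rk≤m) m≤n
  in s , λ i → ⊆-trans (ts⊆v i) v⊆s

module _ {k m n r : ℕ} (colour : Thin m n → Fin r) where

  Covers : Fin r → Set
  Covers i = ∀ (τ : Thin k n) → ∃ λ σ → τ ⊆ σ × colour σ ≡ i

  private
    covered? : ∀ i (τ : Thin k n) → Dec (∃ λ σ → τ ⊆ σ × colour σ ≡ i)
    covered? i τ = ∃? ∈-thinnings λ σ → (τ ⊆? σ) ×-dec (colour σ ≟ i)

  some-colour-covers : r * k ≤ m → m ≤ n → ∃ Covers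
  some-colour-covers rk≤m m≤n with ∃? ∈-allFin (λ i → ∀? ∈-thinnings (covered? i))
  ... | yes covers = covers
  ... | no ¬covers =
    let (σ , τ⊆σ) = cover τ rk≤m m≤n
    in ⊥-elim (τ-uncovered (colour σ) (σ , τ⊆σ (colour σ) , refl))
    where
      uncovered : ∀ i → ∃ λ τ → ¬ ∃ λ σ → τ ⊆ σ × colour σ ≡ i
      uncovered i = ¬∀⇒∃¬ ∈-thinnings (covered? i) (¬covers ∘ (i ,_))
      τ : Fin r → Thin k n
      τ i = proj₁ (uncovered i)
      τ-uncovered : ∀ i → ¬ ∃ λ σ → τ i ⊆ σ × colour σ ≡ i
      τ-uncovered i = proj₂ (uncovered i)

renameᴾ : ∀ {V W : Set} → (V → W) → Poly V → Poly W
renameᴾ h (con q) = con q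
renameᴾ h (var v) = var (h v)
renameᴾ h (p ⊕ q) = renameᴾ h p ⊕ renameᴾ h q
renameᴾ h (p ⊗ q) = renameᴾ h p ⊗ renameᴾ h q
renameᴾ h (⊖ p)   = ⊖ renameᴾ h p

rename : ∀ {V W : Set} → (V → W) → Formula V → Formula W
rename h (p ≐0)   = renameᴾ h p ≐0
rename h (p >0)   = renameᴾ h p >0
rename h (¬ᶠ φ)   = ¬ᶠ rename h φ
rename h (φ ∧ᶠ ψ) = rename h φ ∧ᶠ rename h ψ
rename h (φ ∨ᶠ ψ) = rename h φ ∨ᶠ rename h ψ

⊥ᶠ : ∀ {V : Set} → Formula V
⊥ᶠ = (con 0ℚ ≐0) ∧ᶠ (¬ᶠ (con 0ℚ ≐0))

⊤ᶠ : ∀ {V : Set} → Formula V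
⊤ᶠ = ¬ᶠ ⊥ᶠ

⋀ : ∀ {A V : Set} → List A → (A → Formula V) → Formula V
⋀ []       φ = ⊤ᶠ
⋀ (x ∷ xs) φ = φ x ∧ᶠ ⋀ xs φ

⋁ : ∀ {A V : Set} → List A → (A → Formula V) → Formula V
⋁ []       φ = ⊥ᶠ
⋁ (x ∷ xs) φ = φ x ∨ᶠ ⋁ xs φ

module _ (R : OrderedFieldℚ) where
  open OrderedFieldℚ R

  evalP-rename : ∀ {V W : Set} (h : V → W) (p : Poly V) {ρ : W → Carrier} {σ : V → Carrier} →
                 ρ ∘ h ≗ σ → evalP R (renameᴾ h p) ρ ≡ evalP R p σ
  evalP-rename h (con q) ρ∘h≗σ = refl
  evalP-rename h (var v) ρ∘h≗σ = ρ∘h≗σ v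
  evalP-rename h (p ⊕ q) ρ∘h≗σ = cong₂ _+#_ (evalP-rename h p ρ∘h≗σ) (evalP-rename h q ρ∘h≗σ)
  evalP-rename h (p ⊗ q) ρ∘h≗σ = cong₂ _*#_ (evalP-rename h p ρ∘h≗σ) (evalP-rename h q ρ∘h≗σ)
  evalP-rename h (⊖ p)   ρ∘h≗σ = cong -#_ (evalP-rename h p ρ∘h≗σ)

  ⟦rename⟧ : ∀ {V W : Set} (h : V → W) (φ : Formula V) {ρ : W → Carrier} {σ : V → Carrier} →
             ρ ∘ h ≗ σ → ⟦_⟧ R (rename h φ) ρ ⇔ ⟦_⟧ R φ σ
  ⟦rename⟧ h (p ≐0) ρ∘h≗σ = let e = evalP-rename h p ρ∘h≗σ in mk⇔ (trans (sym e)) (trans e)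
  ⟦rename⟧ h (p >0) ρ∘h≗σ =
    let e = evalP-rename h p ρ∘h≗σ in mk⇔ (subst (zero# <#_) e) (subst (zero# <#_) (sym e))
  ⟦rename⟧ h (¬ᶠ φ) {ρ} ρ∘h≗σ =
    let open Equivalence (⟦rename⟧ h φ {ρ} ρ∘h≗σ) in mk⇔ (λ ¬a b → ¬a (from b)) (λ ¬b a → ¬b (to a))
  ⟦rename⟧ h (φ ∧ᶠ ψ) ρ∘h≗σ = ⟦rename⟧ h φ ρ∘h≗σ ×-⇔ ⟦rename⟧ h ψ ρ∘h≗σ
  ⟦rename⟧ h (φ ∨ᶠ ψ) ρ∘h≗σ = ⟦rename⟧ h φ ρ∘h≗σ ⊎-⇔ ⟦rename⟧ h ψ ρ∘h≗σ

  ⟦⋀⟧ : ∀ {A V : Set} (xs : List A) (φ : A → Formula V) {ρ : V → Carrier} →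
        ⟦_⟧ R (⋀ xs φ) ρ ⇔ All (λ x → ⟦_⟧ R (φ x) ρ) xs
  ⟦⋀⟧ []       φ = mk⇔ (λ _ → []) (λ _ (0≡0 , 0≢0) → 0≢0 0≡0)
  ⟦⋀⟧ (x ∷ xs) φ = mk⇔ (λ (a , as) → a ∷ Equivalence.to (⟦⋀⟧ xs φ) as)
                       (λ { (a ∷ as) → a , Equivalence.from (⟦⋀⟧ xs φ) as })

  ⟦⋁⟧ : ∀ {A V : Set} (xs : List A) (φ : A → Formula V) {ρ : V → Carrier} →
        ⟦_⟧ R (⋁ xs φ) ρ ⇔ Any (λ x → ⟦_⟧ R (φ x) ρ) xs
  ⟦⋁⟧ []       φ = mk⇔ (λ (0≡0 , 0≢0) → ⊥-elim (0≢0 0≡0)) λ ()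
  ⟦⋁⟧ (x ∷ xs) φ = mk⇔
    (λ { (inj₁ a) → Any.here a ; (inj₂ as) → Any.there (Equivalence.to (⟦⋁⟧ xs φ) as) })
    (λ { (Any.here a) → inj₁ a ; (Any.there as) → inj₂ (Equivalence.from (⟦⋁⟧ xs φ) as) })

module _ (R : OrderedFieldℚ) {d : ℕ} where

  HoldsEverywhere-∘ : ∀ {k m n} {Φ : Pred d k} {b : Fin n → Point R d} {g : Fin m → Fin n} →
                      Increasing g → HoldsEverywhere R Φ b → HoldsEverywhere R Φ (b ∘ g)
  HoldsEverywhere-∘ g↑ he ι ι↑ = he _ (∘-increasing g↑ ι↑)

  Good-map : ∀ {k l r s n N} {Φs : Fin r → Pred d k} {Ψs : Fin s → Pred d l} →
             (∀ (b : Fin n → Point R d) i → HoldsEverywhere R (Φs i) b →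
                ∃ λ j → HoldsEverywhere R (Ψs j) b) →
             Good R Φs n N → Good R Ψs n N
  Good-map transfer good a = let (s , s↑ , i , he) = good a in s , s↑ , transfer (a ∘ s) i he

  Good-mono : ∀ {k r n n′ N} {Φs : Fin r → Pred d k} → n ≤ n′ → Good R Φs n′ N → Good R Φs n N
  Good-mono {n = n} {n′} {Φs = Φs} n≤n′ good a =
    let (s , s↑ , i , he) = good a
    in s ∘ inject , ∘-increasing s↑ inject↑ ,
       i , HoldsEverywhere-∘ {Φ = Φs i} {b = a ∘ s} inject↑ he
    where
      inject : Fin n → Fin n′
      inject t = inject≤ t n≤n′
      inject↑ : Increasing inject
      inject↑ = inject≤-increasing n≤n′

  IsESValue-cong : ∀ {k l r s n N} {Φs : Fin r → Pred d k} {Ψs : Fin s → Pred d l} →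
                   (∀ M → Good R Φs n M ⇔ Good R Ψs n M) → IsESValue R Φs n N ⇔ IsESValue R Ψs n N
  IsESValue-cong {N = N} good⇔ = mk⇔
    (λ (good , minimal) → to (good⇔ N) good , λ M M<N → minimal M M<N ∘ from (good⇔ M))
    (λ (good , minimal) → from (good⇔ N) good , λ M M<N → minimal M M<N ∘ to (good⇔ M))
    where open Equivalence

module _ {d k r : ℕ} (Φs : Fin r → Pred d k) where

  Φ̄ : Pred d (r * k)
  Φ̄ = ⋁ (allFin r) λ i → ⋀ (thinnings k (r * k)) λ f → rename (map₁ (embed f)) (Φs i)

  module _ (R : OrderedFieldℚ) where
    open Equivalence

    Φ̄-intro : (x : Fin (r * k) → Point R d) (i : Fin r) →
              (∀ f → ⟦_⟧ R (Φs i) (uncurry (x ∘ embed f))) → ⟦_⟧ R Φ̄ (uncurry x)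
    Φ̄-intro x i Φᵢ-holds =
      from (⟦⋁⟧ R (allFin r) _) (from (Any⇔∃ ∈-allFin) (i ,
        from (⟦⋀⟧ R (thinnings k (r * k)) _) (from (All⇔∀ ∈-thinnings) λ f →
          from (⟦rename⟧ R (map₁ (embed f)) (Φs i) λ _ → refl) (Φᵢ-holds f))))

    Φ̄-elim : (x : Fin (r * k) → Point R d) → ⟦_⟧ R Φ̄ (uncurry x) →
             ∃ λ i → ∀ f → ⟦_⟧ R (rename (map₁ (embed f)) (Φs i)) (uncurry x)
    Φ̄-elim x Φ̄-holds =
      let (i , ⋀-holds) = to (Any⇔∃ ∈-allFin) (to (⟦⋁⟧ R (allFin r) _) Φ̄-holds)
      in i , to (All⇔∀ ∈-thinnings) (to (⟦⋀⟧ R (thinnings k (r * k)) _) ⋀-holds)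

    HoldsEverywhere-Φ̄⁺ : ∀ {n} (b : Fin n → Point R d) i →
                         HoldsEverywhere R (Φs i) b → HoldsEverywhere R Φ̄ b
    HoldsEverywhere-Φ̄⁺ b i he ι ι↑ =
      Φ̄-intro (b ∘ ι) i λ f → he (ι ∘ embed f) (∘-increasing ι↑ (embed-increasing f))

    HoldsEverywhere-Φ̄⁻ : ∀ {n} (b : Fin n → Point R d) → r * k ≤ n → HoldsEverywhere R Φ̄ b →
                         ∃ λ i → HoldsEverywhere R (Φs i) b
    HoldsEverywhere-Φ̄⁻ {n} b rk≤n he =
      let (i , i-covers) = some-colour-covers colour ≤-refl rk≤n
      in i , λ ι ι↑ →
        let (τ , τ≗ι) = increasing⇒thin ι ι↑
            (σ , τ⊆σ , colourσ≡i) = i-covers τ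
            (f , σ∘f≗τ) = ⊆⇒factor τ⊆σ
            point≗ : uncurry (b ∘ embed σ) ∘ map₁ (embed f) ≗ uncurry (b ∘ ι)
            point≗ (j , c) = cong (λ y → b y c) (trans (σ∘f≗τ j) (τ≗ι j))
        in subst (λ i → ⟦_⟧ R (Φs i) (uncurry (b ∘ ι))) colourσ≡i
             (to (⟦rename⟧ R (map₁ (embed f)) (Φs (colour σ)) point≗) (proj₂ (colouring σ) f))
      where
        colouring : (σ : Thin (r * k) n) →
                    ∃ λ i → ∀ f → ⟦_⟧ R (rename (map₁ (embed f)) (Φs i)) (uncurry (b ∘ embed σ))
        colouring σ = Φ̄-elim (b ∘ embed σ) (he (embed σ) (embed-increasing σ))
        colour : Thin (r * k) n → Fin r
        colour σ = proj₁ (colouring σ)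

    Good-Φ̄⁺ : ∀ {n N} → Good R Φs n N → Good R (single Φ̄) n N
    Good-Φ̄⁺ = Good-map R {Φs = Φs} {Ψs = single Φ̄} λ b i he → zero , HoldsEverywhere-Φ̄⁺ b i he

    Good-Φ̄⁻ : ∀ {n N} → r * k ≤ n → Good R (single Φ̄) n N → Good R Φs n N
    Good-Φ̄⁻ rk≤n = Good-map R {Φs = single Φ̄} {Ψs = Φs} λ b _ → HoldsEverywhere-Φ̄⁻ b rk≤n

    IsErdosSzekeres-Φ̄⁻ : IsErdosSzekeres R (single Φ̄) → IsErdosSzekeres R Φs
    IsErdosSzekeres-Φ̄⁻ es n =
      let (N , good) = es (n + r * k)
      in N , Good-mono R {Φs = Φs} (m≤m+n n (r * k)) (Good-Φ̄⁻ (m≤n+m (r * k) n) good)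

    IsErdosSzekeres-Φ̄⁺ : IsErdosSzekeres R Φs → IsErdosSzekeres R (single Φ̄)
    IsErdosSzekeres-Φ̄⁺ es n = let (N , good) = es n in N , Good-Φ̄⁺ good

lemma21 : (d k r : ℕ) (Φs : Fin r → Pred d k) →
    Σ (Pred d (r * k)) λ Φbar → (R : OrderedFieldℚ) →
      (IsErdosSzekeres R (single Φbar) ⇔ IsErdosSzekeres R Φs)
      × (IsErdosSzekeres R Φs →
          (n : ℕ) → r * k ≤ n → (N : ℕ) →
          IsESValue R (single Φbar) n N ⇔ IsESValue R Φs n N)
lemma21 d k r Φs = Φ̄ Φs , λ R →
  mk⇔ (IsErdosSzekeres-Φ̄⁻ Φs R) (IsErdosSzekeres-Φ̄⁺ Φs R) ,
  λ _ n rk≤n N → IsESValue-cong R {Φs = single (Φ̄ Φs)} {Ψs = Φs} λ M →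
    mk⇔ (Good-Φ̄⁻ Φs R rk≤n) (Good-Φ̄⁺ Φs R)
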